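{- Let $p$ be an odd prime and $a$ a rational number with denominator not divisible by $p$ such that $p\nmid(16a^2-1)$. Then $$\sum_{k=0}^{[p/4]}\binom{4k}{2k}a^{2k}\equiv\begin{cases}0\pmod p&\text{if }\big(\frac{1-16a^2}p\big)=-1,\\ \big(\frac{1-4a}p\big)\pmod p&\text{if }\big(\frac{1-16a^2}p\big)=1.\end{cases}$$
   Context: $[x]$ is the greatest integer not exceeding $x$. For a rational $r$ with denominator prime to $p$, $\big(\frac rp\big)$ is the Legendre symbol of its residue mod $p$; congruences are in the ring of such rationals. -}

module Defs where

open import Data.Nat as ℕ using (ℕ; zero; suc)
open import Data.Nat.Divisibility as ℕD using ()
open import Data.Nat.Combinatorics using (_C_)
open import Data.Integer as ℤ using (ℤ; +_)
open import Data.Integer.Divisibility as ℤD using ()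
open import Data.Rational as ℚ using (ℚ; ↥_; ↧ₙ_; 0ℚ; 1ℚ; _*_; _+_; _-_)
open import Data.Product using (∃; _×_)
open import Relation.Nullary using (¬_)
open import Relation.Binary.PropositionalEquality using (_≡_)

infixr 8 _^ℚ_
_^ℚ_ : ℚ → ℕ → ℚ
x ^ℚ zero    = 1ℚ
x ^ℚ (suc n) = x * (x ^ℚ n)

ℕtoℚ : ℕ → ℚ
ℕtoℚ n = ℚ.fromℚᵘ (Data.Rational.Unnormalised.mkℚᵘ (+ n) 0)
  where import Data.Rational.Unnormalised

sumTo : ℕ → (ℕ → ℚ) → ℚ
sumTo zero    f = f 0
sumTo (suc n) f = sumTo n f + f (suc n)

-- p does not divide the denominator of r (r lies in ℤ_(p))
pIntegral : ℕ → ℚ → Set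
pIntegral p r = ¬ (p ℕD.∣ (↧ₙ r))

-- congruence x ≡ y (mod p) in the ring of rationals with denominator prime to p:
-- p divides the numerator of x - y
infix 4 _≡ℚ_[modℚ_]
_≡ℚ_[modℚ_] : ℚ → ℚ → ℕ → Set
x  ≡ℚ y [modℚ p ] = (+ p) ℤD.∣ ↥ (x - y)

ℤtoℚ : ℤ → ℚ
ℤtoℚ n = n ℚ./ 1

-- Legendre p r ε : ε is the Legendre symbol (r/p) of the residue of r mod p
data Legendre (p : ℕ) (r : ℚ) : ℤ → Set where
  leg0  : r  ≡ℚ 0ℚ [modℚ p ] → Legendre p r (+ 0)
  leg1  : ¬ (r  ≡ℚ 0ℚ [modℚ p ]) → (∃ λ (x : ℤ) → r  ≡ℚ ℤtoℚ x * ℤtoℚ x [modℚ p ]) →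
          Legendre p r (+ 1)
  leg-1 : ¬ (r  ≡ℚ 0ℚ [modℚ p ]) → ¬ (∃ λ (x : ℤ) → r  ≡ℚ ℤtoℚ x * ℤtoℚ x [modℚ p ]) →
          Legendre p r (ℤ.- (+ 1))

module Submission where

-- Over the integers, with F(x) = Σ_{j ≤ h} C(2j,j) x^j, the even terms give
--   2 · Σ_{k ≤ [h/2]} C(4k,2k) x^{2k} = F(x) + F(-x),   and [h/2] = [p/4].
-- Modulo p one has C(2j,j) ≡ (-4)^j C(h,j) for j ≤ h, so the binomial theorem gives
-- F(x) ≡ (1-4x)^h and hence 2S ≡ (1-4x)^h + (1+4x)^h.  With u = 1-4x, v = 1+4x,
-- w = uv = 1-16x², Euler's criterion turns Legendre symbols into h-th powers:
-- v^h ≡ u^h · w^h, so 2S ≡ u^h (1 + (w/p)), which is 0 or 2 (u/p).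

open import Data.Empty using (⊥-elim)
open import Data.Integer as ℤ using (ℤ; +_; -[1+_]; _+_; _*_; _-_; -_; _^_)
import Data.Integer.Properties as ℤP
import Data.Integer.Divisibility.Signed as ℤ∣
open import Data.Integer.GCD using (gcd)
open import Data.Integer.Tactic.RingSolver using (solve-∀)
open import Data.List using (List; []; _∷_; length; replicate; applyUpTo)
open import Data.List.Properties using (length-applyUpTo; length-replicate)
open import Data.List.Relation.Unary.All as All using (All; []; _∷_)
import Data.List.Relation.Unary.All.Properties as AllProperties
open import Data.List.Relation.Unary.AllPairs using (AllPairs; _∷_)
import Data.List.Relation.Unary.AllPairs.Properties as AllPairs
open import Data.Nat as ℕ using (ℕ; zero; suc; z≤n; s≤s)
import Data.Nat.DivMod as ℕ÷
import Data.Nat.Divisibility as ℕ∣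
import Data.Nat.Properties as ℕP
import Data.Nat.Tactic.RingSolver as ℕRing
open import Data.Nat.Combinatorics
  using (_C_; nCk+nC[k+1]≡[n+1]C[k+1]; nC1≡n; nCn≡1; k>n⇒nCk≡0; nCk≡nC[n∸k])
open import Data.Nat.Primality using (Prime; euclidsLemma; prime⇒nonTrivial)
open import Data.Product using (∃; _×_; _,_; proj₁; proj₂)
open import Data.Rational as ℚ using (ℚ; mkℚ; ↥_; ↧_; 0ℚ; 1ℚ)
import Data.Rational.Properties as ℚP
open import Data.Sum using (_⊎_; inj₁; inj₂; [_,_]′)
open import Function using (_∘_)
open import Relation.Binary using (Setoid)
import Relation.Binary.Reasoning.Setoid as SetoidReasoning
open import Relation.Binary.PropositionalEquality
open import Relation.Nullary using (¬_)
open import Defs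

sumℤ : ℕ → (ℕ → ℤ) → ℤ
sumℤ zero    f = f 0
sumℤ (suc n) f = sumℤ n f + f (suc n)

sumℤ-cong : ∀ n {f g : ℕ → ℤ} → (∀ j → f j ≡ g j) → sumℤ n f ≡ sumℤ n g
sumℤ-cong zero    f≡g = f≡g 0
sumℤ-cong (suc n) f≡g = cong₂ _+_ (sumℤ-cong n f≡g) (f≡g (suc n))

sumℤ-+ : ∀ n f g → sumℤ n (λ j → f j + g j) ≡ sumℤ n f + sumℤ n g
sumℤ-+ zero    f g = refl
sumℤ-+ (suc n) f g = trans (cong (_+ (f (suc n) + g (suc n))) (sumℤ-+ n f g))
                           (interchange (sumℤ n f) (sumℤ n g) (f (suc n)) (g (suc n)))
  where interchange : ∀ a b c d → (a + b) + (c + d) ≡ (a + c) + (b + d)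
        interchange = solve-∀

sumℤ-*ˡ : ∀ n c f → c * sumℤ n f ≡ sumℤ n (λ j → c * f j)
sumℤ-*ˡ zero    c f = refl
sumℤ-*ˡ (suc n) c f = trans (ℤP.*-distribˡ-+ c (sumℤ n f) (f (suc n)))
                            (cong (_+ c * f (suc n)) (sumℤ-*ˡ n c f))

sumℤ-shift : ∀ n f → sumℤ (suc n) f ≡ f 0 + sumℤ n (f ∘ suc)
sumℤ-shift zero    f = refl
sumℤ-shift (suc n) f = trans (cong (_+ f (suc (suc n))) (sumℤ-shift n f)) (ℤP.+-assoc (f 0) _ _)

^-distrib-* : ∀ x y n → (x * y) ^ n ≡ x ^ n * y ^ n
^-distrib-* x y zero    = refl
^-distrib-* x y (suc n) = trans (cong ((x * y) *_) (^-distrib-* x y n)) (regroup x y _ _)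
  where regroup : ∀ x y a b → (x * y) * (a * b) ≡ (x * a) * (y * b)
        regroup = solve-∀

^-double : ∀ x k → x ^ (k ℕ.+ k) ≡ (x * x) ^ k
^-double x k = trans (ℤP.^-distribˡ-+-* x k k) (sym (^-distrib-* x x k))

neg-^-even : ∀ x k → (- x) ^ (k ℕ.+ k) ≡ x ^ (k ℕ.+ k)
neg-^-even x k = trans (^-double (- x) k) (trans (cong (_^ k) (neg-square x)) (sym (^-double x k)))
  where neg-square : ∀ x → (- x) * (- x) ≡ x * x
        neg-square = solve-∀

neg-^-odd : ∀ x k → (- x) ^ suc (k ℕ.+ k) ≡ - (x ^ suc (k ℕ.+ k))
neg-^-odd x k = trans (cong ((- x) *_) (neg-^-even x k)) (sym (ℤP.neg-distribˡ-* x _))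

parity : ∀ n → ∃ λ t → n ≡ t ℕ.+ t ⊎ n ≡ suc (t ℕ.+ t)
parity zero = 0 , inj₁ refl
parity (suc n) with parity n
... | t , inj₁ n≡2t   = t , inj₂ (cong suc n≡2t)
... | t , inj₂ n≡2t+1 = suc t , inj₁ (trans (cong suc n≡2t+1) (cong suc (sym (ℕP.+-suc t t))))

div-4 : ∀ r t → r ℕ.< 4 → (r ℕ.+ t ℕ.* 4) ℕ./ 4 ≡ t
div-4 r t r<4 =
  trans (ℕ÷.+-distrib-/-∣ʳ r (ℕ∣.n∣m*n t)) (cong₂ ℕ._+_ (ℕ÷.m<n⇒m/n≡0 r<4) (ℕ÷.m*n/n≡m t 4))

C-absorb : ∀ n k → suc k ℕ.* (suc n C suc k) ≡ suc n ℕ.* (n C k)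
C-absorb n       zero    =
  trans (ℕP.*-identityˡ _) (trans (nC1≡n (suc n)) (sym (ℕP.*-identityʳ (suc n))))
C-absorb zero    (suc k) = ℕP.*-zeroʳ (suc (suc k))
C-absorb (suc n) (suc k) = begin
  suc (suc k) ℕ.* (suc (suc n) C suc (suc k))        ≡⟨ cong (suc (suc k) ℕ.*_) (sym (pascal (suc n) (suc k))) ⟩
  suc (suc k) ℕ.* (a ℕ.+ b)                          ≡⟨ split k a b ⟩
  (suc k ℕ.* a ℕ.+ a) ℕ.+ suc (suc k) ℕ.* b          ≡⟨ cong₂ (λ x y → (x ℕ.+ a) ℕ.+ y) (C-absorb n k) (C-absorb n (suc k)) ⟩
  (suc n ℕ.* c ℕ.+ a) ℕ.+ suc n ℕ.* d                ≡⟨ cong (λ x → (suc n ℕ.* c ℕ.+ x) ℕ.+ suc n ℕ.* d) (sym (pascal n k)) ⟩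
  (suc n ℕ.* c ℕ.+ (c ℕ.+ d)) ℕ.+ suc n ℕ.* d        ≡⟨ merge n c d ⟩
  suc (suc n) ℕ.* (c ℕ.+ d)                          ≡⟨ cong (suc (suc n) ℕ.*_) (pascal n k) ⟩
  suc (suc n) ℕ.* (suc n C suc k)                    ∎
  where
  open ≡-Reasoning
  pascal : ∀ n k → n C k ℕ.+ n C suc k ≡ suc n C suc k
  pascal = nCk+nC[k+1]≡[n+1]C[k+1]
  a b c d : ℕ
  a = suc n C suc k ; b = suc n C suc (suc k) ; c = n C k ; d = n C suc k
  split : ∀ k a b → suc (suc k) ℕ.* (a ℕ.+ b) ≡ (suc k ℕ.* a ℕ.+ a) ℕ.+ suc (suc k) ℕ.* b
  split = ℕRing.solve-∀
  merge : ∀ n c d → (suc n ℕ.* c ℕ.+ (c ℕ.+ d)) ℕ.+ suc n ℕ.* d ≡ suc (suc n) ℕ.* (c ℕ.+ d)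
  merge = ℕRing.solve-∀

C-absorbℤ : ∀ n k → + suc k * + (n C suc k) ≡ (+ n - + k) * + (n C k)
C-absorbℤ n k = rearrange (+ k) (+ n) (+ (n C k)) (+ (n C suc k)) absorbed
  where
  absorbed : (+ 1 + + k) * (+ (n C k) + + (n C suc k)) ≡ (+ 1 + + n) * + (n C k)
  absorbed = begin
    + suc k * (+ (n C k) + + (n C suc k))  ≡⟨ cong (+ suc k *_) (sym (ℤP.pos-+ (n C k) _)) ⟩
    + suc k * + (n C k ℕ.+ n C suc k)      ≡⟨ sym (ℤP.pos-* (suc k) _) ⟩
    + (suc k ℕ.* (n C k ℕ.+ n C suc k))    ≡⟨ cong (λ m → + (suc k ℕ.* m)) (nCk+nC[k+1]≡[n+1]C[k+1] n k) ⟩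
    + (suc k ℕ.* (suc n C suc k))          ≡⟨ cong +_ (C-absorb n k) ⟩
    + (suc n ℕ.* (n C k))                  ≡⟨ ℤP.pos-* (suc n) _ ⟩
    + suc n * + (n C k)                    ∎
    where open ≡-Reasoning
  rearrange : ∀ k n A B → (+ 1 + k) * (A + B) ≡ (+ 1 + n) * A → (+ 1 + k) * B ≡ (n - k) * A
  rearrange k n A B eq = trans (isolate k A B) (trans (cong (_- (+ 1 + k) * A) eq) (collect k n A))
    where
    isolate : ∀ k A B → (+ 1 + k) * B ≡ (+ 1 + k) * (A + B) - (+ 1 + k) * A
    isolate = solve-∀
    collect : ∀ k n A → (+ 1 + n) * A - (+ 1 + k) * A ≡ (n - k) * A
    collect = solve-∀

central-rec : ∀ i → suc i ℕ.* ((suc i ℕ.+ suc i) C suc i) ≡ 2 ℕ.* (suc (i ℕ.+ i) ℕ.* ((i ℕ.+ i) C i))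
central-rec i = begin
  suc i ℕ.* (suc (i ℕ.+ suc i) C suc i)      ≡⟨ C-absorb (i ℕ.+ suc i) i ⟩
  suc (i ℕ.+ suc i) ℕ.* ((i ℕ.+ suc i) C i)  ≡⟨ cong (λ m → suc (i ℕ.+ suc i) ℕ.* (m C i)) (ℕP.+-suc i i) ⟩
  suc (i ℕ.+ suc i) ℕ.* (suc (i ℕ.+ i) C i)  ≡⟨ cong (suc (i ℕ.+ suc i) ℕ.*_) symmetric ⟩
  suc (i ℕ.+ suc i) ℕ.* (suc (i ℕ.+ i) C suc i) ≡⟨ double i _ ⟩
  2 ℕ.* (suc i ℕ.* (suc (i ℕ.+ i) C suc i))  ≡⟨ cong (2 ℕ.*_) (C-absorb (i ℕ.+ i) i) ⟩
  2 ℕ.* (suc (i ℕ.+ i) ℕ.* ((i ℕ.+ i) C i))  ∎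
  where
  open ≡-Reasoning
  symmetric : suc (i ℕ.+ i) C i ≡ suc (i ℕ.+ i) C suc i
  symmetric = trans (nCk≡nC[n∸k] (ℕP.m≤n+m i (suc i))) (cong (suc (i ℕ.+ i) C_) (ℕP.m+n∸n≡m (suc i) i))
  double : ∀ i B → suc (i ℕ.+ suc i) ℕ.* B ≡ 2 ℕ.* (suc i ℕ.* B)
  double = ℕRing.solve-∀

central-recℤ : ∀ i → + suc i * + ((suc i ℕ.+ suc i) C suc i) ≡ + 2 * ((+ 1 + (+ i + + i)) * + ((i ℕ.+ i) C i))
central-recℤ i = begin
  + suc i * + ((suc i ℕ.+ suc i) C suc i)     ≡⟨ ℤP.pos-* (suc i) ((suc i ℕ.+ suc i) C suc i) ⟨
  + (suc i ℕ.* ((suc i ℕ.+ suc i) C suc i))   ≡⟨ cong +_ (central-rec i) ⟩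
  + (2 ℕ.* (suc (i ℕ.+ i) ℕ.* c))             ≡⟨ ℤP.pos-* 2 (suc (i ℕ.+ i) ℕ.* c) ⟩
  + 2 * + (suc (i ℕ.+ i) ℕ.* c)               ≡⟨ cong (+ 2 *_) (ℤP.pos-* (suc (i ℕ.+ i)) c) ⟩
  + 2 * ((+ 1 + + (i ℕ.+ i)) * + c)           ≡⟨ cong (λ t → + 2 * ((+ 1 + t) * + c)) (ℤP.pos-+ i i) ⟩
  + 2 * ((+ 1 + (+ i + + i)) * + c)           ∎
  where
  open ≡-Reasoning
  c : ℕ
  c = (i ℕ.+ i) C i

binomial-theorem : ∀ n y → (+ 1 + y) ^ n ≡ sumℤ n (λ j → + (n C j) * y ^ j)
binomial-theorem zero    y = refl
binomial-theorem (suc n) y = begin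
  (+ 1 + y) * (+ 1 + y) ^ n                        ≡⟨ cong ((+ 1 + y) *_) (binomial-theorem n y) ⟩
  (+ 1 + y) * sumℤ n f                             ≡⟨ expand y (sumℤ n f) tail top-vanishes ⟩
  + 1 + (y * sumℤ n f + tail)                      ≡⟨ cong (λ s → + 1 + (s + tail)) (sumℤ-*ˡ n y f) ⟩
  + 1 + (sumℤ n (λ j → y * f j) + tail)            ≡⟨ cong (λ s → + 1 + s) (sym (sumℤ-+ n _ _)) ⟩
  + 1 + sumℤ n (λ j → y * f j + f (suc j))         ≡⟨ cong (λ s → + 1 + s) (sumℤ-cong n pascal-term) ⟩
  + 1 + sumℤ n (λ j → + (suc n C suc j) * y ^ suc j) ≡⟨ sym (sumℤ-shift n (λ j → + (suc n C j) * y ^ j)) ⟩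
  sumℤ (suc n) (λ j → + (suc n C j) * y ^ j)       ∎
  where
  open ≡-Reasoning
  f : ℕ → ℤ
  f j = + (n C j) * y ^ j
  tail : ℤ
  tail = sumℤ n (f ∘ suc)
  -- the shifted sum misses only the vanishing term C(n,n+1) y^{n+1}
  top-vanishes : + 1 + tail ≡ sumℤ n f
  top-vanishes = trans (sym (sumℤ-shift n f))
    (trans (cong (λ m → sumℤ n f + + m * y ^ suc n) (k>n⇒nCk≡0 (ℕP.n<1+n n))) (ℤP.+-identityʳ _))
  expand : ∀ y s t → + 1 + t ≡ s → (+ 1 + y) * s ≡ + 1 + (y * s + t)
  expand y _ t refl = ring y t
    where ring : ∀ y t → (+ 1 + y) * (+ 1 + t) ≡ + 1 + (y * (+ 1 + t) + t)
          ring = solve-∀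
  pascal-term : ∀ j → y * f j + f (suc j) ≡ + (suc n C suc j) * y ^ suc j
  pascal-term j = trans (collect y (+ (n C j)) (+ (n C suc j)) (y ^ j))
    (cong (_* (y * y ^ j)) (trans (sym (ℤP.pos-+ (n C j) _)) (cong +_ (nCk+nC[k+1]≡[n+1]C[k+1] n j))))
    where collect : ∀ y a b t → y * (a * t) + b * (y * t) ≡ (a + b) * (y * t)
          collect = solve-∀

even-terms : ∀ (c : ℕ → ℤ) x t n → (n ≡ t ℕ.+ t ⊎ n ≡ suc (t ℕ.+ t)) →
  sumℤ n (λ j → c j * x ^ j) + sumℤ n (λ j → c j * (- x) ^ j) ≡ + 2 * sumℤ t (λ k → c (k ℕ.+ k) * x ^ (k ℕ.+ k))
even-terms c x t n n≡ =
  trans (sym (sumℤ-+ n _ _)) (trans (sumℤ-cong n (λ j → sym (ℤP.*-distribˡ-+ (c j) _ _))) (by-parity n≡))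
  where
  g : ℕ → ℤ
  g j = c j * (x ^ j + (- x) ^ j)
  E : ℕ → ℤ
  E t = sumℤ t (λ k → c (k ℕ.+ k) * x ^ (k ℕ.+ k))
  odd-vanishes : ∀ k → g (suc (k ℕ.+ k)) ≡ + 0
  odd-vanishes k = trans (cong (λ y → c k′ * (x ^ k′ + y)) (neg-^-odd x k)) (cancel (c k′) (x ^ k′))
    where k′ : ℕ
          k′ = suc (k ℕ.+ k)
          cancel : ∀ a y → a * (y + - y) ≡ + 0
          cancel = solve-∀
  even-doubles : ∀ k → g (k ℕ.+ k) ≡ + 2 * (c (k ℕ.+ k) * x ^ (k ℕ.+ k))
  even-doubles k = trans (cong (λ y → c k′ * (x ^ k′ + y)) (neg-^-even x k)) (twice (c k′) (x ^ k′))
    where k′ : ℕ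
          k′ = k ℕ.+ k
          twice : ∀ a y → a * (y + y) ≡ + 2 * (a * y)
          twice = solve-∀
  add-odd : ∀ t → sumℤ (t ℕ.+ t) g ≡ + 2 * E t → sumℤ (suc (t ℕ.+ t)) g ≡ + 2 * E t
  add-odd t ih = trans (cong (λ y → sumℤ (t ℕ.+ t) g + y) (odd-vanishes t)) (trans (ℤP.+-identityʳ _) ih)
  even : ∀ t → sumℤ (t ℕ.+ t) g ≡ + 2 * E t
  even zero    = even-doubles 0
  even (suc t) = trans (cong (λ m → sumℤ m g + g (suc t ℕ.+ suc t)) (ℕP.+-suc t t))
    (trans (cong₂ _+_ (add-odd t (even t)) (even-doubles (suc t))) (sym (ℤP.*-distribˡ-+ (+ 2) (E t) _)))
  by-parity : (n ≡ t ℕ.+ t ⊎ n ≡ suc (t ℕ.+ t)) → sumℤ n g ≡ + 2 * E t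
  by-parity (inj₁ refl) = even t
  by-parity (inj₂ refl) = add-odd t (even t)


module ModPrime (p : ℕ) (p-prime : Prime p) where

  infix 4 _≈_
  record _≈_ (x y : ℤ) : Set where
    constructor mk≈
    field divides-difference : + p ℤ∣.∣ (x - y)

  ≈-by : ∀ {x y} d → + p ℤ∣.∣ d → x - y ≡ d → x ≈ y
  ≈-by d p∣d eq = mk≈ (subst (+ p ℤ∣.∣_) (sym eq) p∣d)

  ≡⇒≈ : ∀ {x y} → x ≡ y → x ≈ y
  ≡⇒≈ {x} refl = ≈-by (+ 0) (ℤ∣.divides (+ 0) refl) (ℤP.+-inverseʳ x)

  ≈-refl : ∀ {x} → x ≈ x
  ≈-refl = ≡⇒≈ refl

  ≈-sym : ∀ {x y} → x ≈ y → y ≈ x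
  ≈-sym {x} {y} (mk≈ d) = ≈-by (- (x - y)) (ℤ∣.∣m⇒∣-m d) (flip x y)
    where flip : ∀ x y → y - x ≡ - (x - y)
          flip = solve-∀

  ≈-trans : ∀ {x y z} → x ≈ y → y ≈ z → x ≈ z
  ≈-trans {x} {y} {z} (mk≈ d) (mk≈ e) = ≈-by _ (ℤ∣.∣m∣n⇒∣m+n d e) (telescope x y z)
    where telescope : ∀ x y z → x - z ≡ (x - y) + (y - z)
          telescope = solve-∀

  ≈-setoid : Setoid _ _
  ≈-setoid = record { Carrier = ℤ ; _≈_ = _≈_
                    ; isEquivalence = record { refl = ≈-refl ; sym = ≈-sym ; trans = ≈-trans } }

  module ≈-Reasoning = SetoidReasoning ≈-setoid

  +-cong : ∀ {x y u v} → x ≈ y → u ≈ v → x + u ≈ y + v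
  +-cong {x} {y} {u} {v} (mk≈ d) (mk≈ e) = ≈-by _ (ℤ∣.∣m∣n⇒∣m+n d e) (regroup x y u v)
    where regroup : ∀ x y u v → (x + u) - (y + v) ≡ (x - y) + (u - v)
          regroup = solve-∀

  *-cong : ∀ {x y u v} → x ≈ y → u ≈ v → x * u ≈ y * v
  *-cong {x} {y} {u} {v} (mk≈ d) (mk≈ e) =
    ≈-by _ (ℤ∣.∣m∣n⇒∣m+n (ℤ∣.∣m⇒∣m*n u d) (ℤ∣.∣n⇒∣m*n y e)) (regroup x y u v)
    where regroup : ∀ x y u v → (x * u) - (y * v) ≡ (x - y) * u + y * (u - v)
          regroup = solve-∀

  +-congˡ : ∀ c {x y} → x ≈ y → c + x ≈ c + y
  +-congˡ c = +-cong (≈-refl {c})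

  *-congˡ : ∀ c {x y} → x ≈ y → c * x ≈ c * y
  *-congˡ c = *-cong (≈-refl {c})

  neg-cong : ∀ {x y} → x ≈ y → - x ≈ - y
  neg-cong {x} {y} (mk≈ d) = ≈-by _ (ℤ∣.∣m⇒∣-m d) (regroup x y)
    where regroup : ∀ x y → - x - - y ≡ - (x - y)
          regroup = solve-∀

  -‿cong : ∀ {x y u v} → x ≈ y → u ≈ v → x - u ≈ y - v
  -‿cong x≈y u≈v = +-cong x≈y (neg-cong u≈v)

  ^-cong : ∀ {x y} n → x ≈ y → x ^ n ≈ y ^ n
  ^-cong zero    x≈y = ≈-refl
  ^-cong (suc n) x≈y = *-cong x≈y (^-cong n x≈y)

  sumℤ-≈ : ∀ n {f g} → (∀ j → j ℕ.≤ n → f j ≈ g j) → sumℤ n f ≈ sumℤ n g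
  sumℤ-≈ zero    f≈g = f≈g 0 z≤n
  sumℤ-≈ (suc n) f≈g = +-cong (sumℤ-≈ n (λ j j≤n → f≈g j (ℕP.m≤n⇒m≤1+n j≤n))) (f≈g (suc n) ℕP.≤-refl)

  sumℤ-≈-first : ∀ n f → (∀ j → 1 ℕ.≤ j → j ℕ.≤ n → f j ≈ + 0) → sumℤ n f ≈ f 0
  sumℤ-≈-first zero    f _     = ≈-refl
  sumℤ-≈-first (suc n) f f≈0 =
    ≈-trans (+-cong (sumℤ-≈-first n f (λ j 1≤j j≤n → f≈0 j 1≤j (ℕP.m≤n⇒m≤1+n j≤n)))
                    (f≈0 (suc n) (s≤s z≤n) ℕP.≤-refl))
            (≡⇒≈ (ℤP.+-identityʳ (f 0)))

  ∣⇒≈0 : ∀ {x} → + p ℤ∣.∣ x → x ≈ + 0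
  ∣⇒≈0 {x} p∣x = ≈-by x p∣x (ℤP.+-identityʳ x)

  ≈0⇒∣ : ∀ {x} → x ≈ + 0 → + p ℤ∣.∣ x
  ≈0⇒∣ {x} (mk≈ d) = subst (+ p ℤ∣.∣_) (ℤP.+-identityʳ x) d

  multiple≈0 : ∀ x → x * + p ≈ + 0
  multiple≈0 x = ∣⇒≈0 (ℤ∣.∣n⇒∣m*n x ℤ∣.∣-refl)

  difference≈0 : ∀ {x y} → x ≈ y → x - y ≈ + 0
  difference≈0 (mk≈ d) = ∣⇒≈0 d

  difference≈0⇒≈ : ∀ {x y} → x - y ≈ + 0 → x ≈ y
  difference≈0⇒≈ x-y≈0 = mk≈ (≈0⇒∣ x-y≈0)

  *≈0⇒ : ∀ x y → x * y ≈ + 0 → x ≈ + 0 ⊎ y ≈ + 0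
  *≈0⇒ x y xy≈0 with euclidsLemma ℤ.∣ x ∣ ℤ.∣ y ∣ p-prime
                       (subst (p ℕ∣.∣_) (ℤP.abs-* x y) (ℤ∣.∣⇒∣ᵤ (≈0⇒∣ xy≈0)))
  ... | inj₁ p∣x = inj₁ (∣⇒≈0 (ℤ∣.∣ᵤ⇒∣ p∣x))
  ... | inj₂ p∣y = inj₂ (∣⇒≈0 (ℤ∣.∣ᵤ⇒∣ p∣y))

  *-cancelˡ : ∀ {c x y} → ¬ c ≈ + 0 → c * x ≈ c * y → x ≈ y
  *-cancelˡ {c} {x} {y} c≉0 cx≈cy =
    [ (λ c≈0 → ⊥-elim (c≉0 c≈0)) , difference≈0⇒≈ ]′
    (*≈0⇒ c (x - y) (≈-trans (≡⇒≈ (distrib c x y)) (difference≈0 cx≈cy)))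
    where distrib : ∀ c x y → c * (x - y) ≡ c * x - c * y
          distrib = solve-∀

  *≉0⇒ : ∀ a b → ¬ a * b ≈ + 0 → ¬ a ≈ + 0 × ¬ b ≈ + 0
  *≉0⇒ a b ab≉0 = (λ a≈0 → ab≉0 (≈-trans (*-cong a≈0 (≈-refl {b})) (≡⇒≈ (ℤP.*-zeroˡ b))))
                , (λ b≈0 → ab≉0 (≈-trans (*-congˡ a b≈0) (≡⇒≈ (ℤP.*-zeroʳ a))))

  pos≉0 : ∀ {n} → 0 ℕ.< n → n ℕ.< p → ¬ + n ≈ + 0
  pos≉0 {n} 0<n n<p n≈0 = ℕP.<⇒≱ n<p (ℕ∣.∣⇒≤ ⦃ ℕ.>-nonZero 0<n ⦄ (ℤ∣.∣⇒∣ᵤ (≈0⇒∣ n≈0)))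

  1<p : 1 ℕ.< p
  1<p = ℕ.nonTrivial⇒n>1 p ⦃ prime⇒nonTrivial p-prime ⦄

  1≉0 : ¬ + 1 ≈ + 0
  1≉0 = pos≉0 (s≤s z≤n) 1<p

  square≈1 : ∀ {t} → t * t ≈ + 1 → t ≈ + 1 ⊎ t ≈ - + 1
  square≈1 {t} tt≈1 = [ inj₁ ∘ difference≈0⇒≈ , inj₂ ∘ t+1≈0⇒ ]′
                         (*≈0⇒ (t - + 1) (t + + 1) (≈-trans (≡⇒≈ (factor t)) (difference≈0 tt≈1)))
    where
    factor : ∀ t → (t - + 1) * (t + + 1) ≡ t * t - + 1
    factor = solve-∀
    t+1≈0⇒ : t + + 1 ≈ + 0 → t ≈ - + 1
    t+1≈0⇒ t+1≈0 = difference≈0⇒≈ (≈-trans (≡⇒≈ (cong (λ y → t + y) (ℤP.neg-involutive (+ 1)))) t+1≈0)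

  -- Monic polynomials in Horner form: c₀ ∷ … ∷ cₙ₋₁ denotes c₀ + c₁x + … + cₙ₋₁xⁿ⁻¹ + xⁿ.
  monic : List ℤ → ℤ → ℤ
  monic []       x = + 1
  monic (c ∷ cs) x = c + x * monic cs x

  -- The quotient of the monic polynomial c ∷ ds by x - r (it does not depend on c).
  quotient : List ℤ → ℤ → List ℤ
  quotient []       r = []
  quotient (d ∷ ds) r = monic (d ∷ ds) r ∷ quotient ds r

  length-quotient : ∀ ds r → length (quotient ds r) ≡ length ds
  length-quotient []       r = refl
  length-quotient (d ∷ ds) r = cong suc (length-quotient ds r)

  factor-theorem : ∀ c ds r x → monic (c ∷ ds) x ≡ monic (c ∷ ds) r + (x - r) * monic (quotient ds r) x
  factor-theorem c []       r x = linear c x r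
    where linear : ∀ c x r → c + x * + 1 ≡ c + r * + 1 + (x - r) * + 1
          linear = solve-∀
  factor-theorem c (d ∷ ds) r x =
    trans (cong (λ t → c + x * t) (factor-theorem d ds r x))
          (step c x r (monic (d ∷ ds) r) (monic (quotient ds r) x))
    where step : ∀ c x r e q → c + x * (e + (x - r) * q) ≡ (c + r * e) + (x - r) * (e + x * q)
          step = solve-∀

  Root : List ℤ → ℤ → Set
  Root cs r = monic cs r ≈ + 0

  Distinct : List ℤ → Set
  Distinct = AllPairs (λ x y → ¬ x ≈ y)

  roots-of-quotient : ∀ c ds r {rs} → Root (c ∷ ds) r → All (λ s → ¬ r ≈ s) rs →
    All (Root (c ∷ ds)) rs → All (Root (quotient ds r)) rs
  roots-of-quotient c ds r fr≈0 []            []            = []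
  roots-of-quotient c ds r {s ∷ _} fr≈0 (r≉s ∷ r≉rs) (fs≈0 ∷ frs≈0) =
    root-s ∷ roots-of-quotient c ds r fr≈0 r≉rs frs≈0
    where
    product≈0 : (s - r) * monic (quotient ds r) s ≈ + 0
    product≈0 = ≈-trans (≡⇒≈ (remainder-cancels _ _ _ (factor-theorem c ds r s))) (-‿cong fs≈0 fr≈0)
      where
      remainder-cancels : ∀ f e q → f ≡ e + q → q ≡ f - e
      remainder-cancels _ e q refl = cancel e q
        where cancel : ∀ e q → q ≡ e + q - e
              cancel = solve-∀
    root-s : Root (quotient ds r) s
    root-s = [ (λ s-r≈0 → ⊥-elim (r≉s (≈-sym (difference≈0⇒≈ s-r≈0)))) , (λ q≈0 → q≈0) ]′
             (*≈0⇒ _ _ product≈0)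

  root-bound : ∀ cs rs → Distinct rs → All (Root cs) rs → length rs ℕ.≤ length cs
  root-bound cs       []       _              _          = z≤n
  root-bound []       (r ∷ rs) _              (1≈0 ∷ _)  = ⊥-elim (1≉0 1≈0)
  root-bound (c ∷ ds) (r ∷ rs) (r≉rs ∷ rs≠) (fr≈0 ∷ frs≈0) =
    s≤s (subst (length rs ℕ.≤_) (length-quotient ds r)
               (root-bound (quotient ds r) rs rs≠ (roots-of-quotient c ds r fr≈0 r≉rs frs≈0)))

  x^[1+n]-1 : ℕ → List ℤ
  x^[1+n]-1 n = - + 1 ∷ replicate n (+ 0)

  monic-x^[1+n]-1 : ∀ n x → monic (x^[1+n]-1 n) x ≡ x ^ suc n - + 1
  monic-x^[1+n]-1 n x = trans (cong (λ t → - + 1 + x * t) (monomial n)) (ℤP.+-comm (- + 1) (x ^ suc n))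
    where monomial : ∀ n → monic (replicate n (+ 0)) x ≡ x ^ n
          monomial zero    = refl
          monomial (suc n) = trans (ℤP.+-identityˡ _) (cong (x *_) (monomial n))

  unity-root-bound : ∀ n rs → Distinct rs → All (λ r → r ^ suc n ≈ + 1) rs → length rs ℕ.≤ suc n
  unity-root-bound n rs distinct roots =
    subst (length rs ℕ.≤_) (cong suc (length-replicate n))
          (root-bound (x^[1+n]-1 n) rs distinct (All.map (λ {r} → is-root {r}) roots))
    where
    is-root : ∀ {r} → r ^ suc n ≈ + 1 → Root (x^[1+n]-1 n) r
    is-root {r} r^[1+n]≈1 = ≈-trans (≡⇒≈ (monic-x^[1+n]-1 n r)) (difference≈0 r^[1+n]≈1)

  IsSquare : ℤ → Set
  IsSquare u = ∃ λ x → u ≈ x * x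

  -- x ↦ z : the rational x has denominator prime to p and reduces to z modulo p,
  -- i.e. num x ≡ z · den x (mod p).
  infix 4 _↦_
  record _↦_ (x : ℚ) (z : ℤ) : Set where
    constructor mk↦
    field
      den-unit : pIntegral p x
      num≈     : ↥ x ≈ z * ↧ x
  open _↦_

  ¬p∣* : ∀ m n → ¬ p ℕ∣.∣ m → ¬ p ℕ∣.∣ n → ¬ p ℕ∣.∣ (m ℕ.* n)
  ¬p∣* m n p∤m p∤n p∣mn = [ p∤m , p∤n ]′ (euclidsLemma m n p-prime p∣mn)

  ≉0⇒¬p∣ : ∀ {n} → ¬ + n ≈ + 0 → ¬ p ℕ∣.∣ n
  ≉0⇒¬p∣ n≉0 p∣n = n≉0 (∣⇒≈0 (ℤ∣.∣ᵤ⇒∣ p∣n))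

  ¬p∣⇒≉0 : ∀ {n} → ¬ p ℕ∣.∣ n → ¬ + n ≈ + 0
  ¬p∣⇒≉0 p∤n n≈0 = p∤n (ℤ∣.∣⇒∣ᵤ (≈0⇒∣ n≈0))

  -- A fraction i / n with p ∤ n and i ≡ z n reduces to z: the reduced fraction has
  -- num · g = i and den · g = n for g = gcd(i,n), and g is a unit modulo p.
  ↦-/ : ∀ i n .{{_ : ℕ.NonZero n}} z → ¬ p ℕ∣.∣ n → i ≈ z * + n → i ℚ./ n ↦ z
  ↦-/ i n z p∤n i≈zn = mk↦ (≉0⇒¬p∣ (proj₁ den,g≉0)) (cancel-gcd (*≈0⇒ _ _ scaled≈0))
    where
    q : ℚ
    q = i ℚ./ n
    g : ℤ
    g = gcd i (+ n)
    den,g≉0 : ¬ ↧ q ≈ + 0 × ¬ g ≈ + 0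
    den,g≉0 = *≉0⇒ (↧ q) g (subst (λ m → ¬ m ≈ + 0) (sym (ℚP.↧-/ i n)) (¬p∣⇒≉0 p∤n))
    scaled≈0 : (↥ q - z * ↧ q) * g ≈ + 0
    scaled≈0 = ≈-trans (≡⇒≈ (trans (distrib (↥ q) (↧ q) g z)
                                   (cong₂ (λ a b → a - z * b) (ℚP.↥-/ i n) (ℚP.↧-/ i n))))
                       (difference≈0 i≈zn)
      where distrib : ∀ a b g z → (a - z * b) * g ≡ a * g - z * (b * g)
            distrib = solve-∀
    cancel-gcd : ↥ q - z * ↧ q ≈ + 0 ⊎ g ≈ + 0 → ↥ q ≈ z * ↧ q
    cancel-gcd = [ difference≈0⇒≈ , ⊥-elim ∘ proj₂ den,g≉0 ]′

  ↦-ℤ : ∀ z → ℤtoℚ z ↦ z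
  ↦-ℤ z = ↦-/ z 1 z (λ p∣1 → ℕP.<-irrefl (sym (ℕ∣.∣1⇒≡1 p∣1)) 1<p) (≡⇒≈ (sym (ℤP.*-identityʳ z)))

  ↦-1 : 1ℚ ↦ + 1
  ↦-1 = ↦-ℤ (+ 1)

  ↦-0 : 0ℚ ↦ + 0
  ↦-0 = ↦-ℤ (+ 0)

  ↦-+ : ∀ {x y z w} → x ↦ z → y ↦ w → x ℚ.+ y ↦ z + w
  ↦-+ {mkℚ a m _} {mkℚ b n _} {z} {w} (mk↦ p∤m a≈) (mk↦ p∤n b≈) =
    ↦-/ (a * + suc n + b * + suc m) (suc m ℕ.* suc n) (z + w) (¬p∣* _ _ p∤m p∤n)
      (≈-trans (+-cong (*-cong a≈ ≈-refl) (*-cong b≈ ≈-refl))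
               (≡⇒≈ (trans (collect z w (+ suc m) (+ suc n))
                           (cong ((z + w) *_) (sym (ℤP.pos-* (suc m) (suc n)))))))
    where collect : ∀ z w A B → z * A * B + w * B * A ≡ (z + w) * (A * B)
          collect = solve-∀

  ↦-* : ∀ {x y z w} → x ↦ z → y ↦ w → x ℚ.* y ↦ z * w
  ↦-* {mkℚ a m _} {mkℚ b n _} {z} {w} (mk↦ p∤m a≈) (mk↦ p∤n b≈) =
    ↦-/ (a * b) (suc m ℕ.* suc n) (z * w) (¬p∣* _ _ p∤m p∤n)
      (≈-trans (*-cong a≈ b≈)
               (≡⇒≈ (trans (collect z w (+ suc m) (+ suc n))
                           (cong ((z * w) *_) (sym (ℤP.pos-* (suc m) (suc n)))))))
    where collect : ∀ z w A B → (z * A) * (w * B) ≡ (z * w) * (A * B)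
          collect = solve-∀

  ↦-neg : ∀ {x z} → x ↦ z → ℚ.- x ↦ - z
  ↦-neg {x} {z} (mk↦ p∤den num≈) = mk↦
    (subst (λ d → ¬ p ℕ∣.∣ d) (sym (cong ℤ.∣_∣ (ℚP.↧-neg x))) p∤den)
    (≈-trans (≡⇒≈ (ℚP.↥-neg x))
      (≈-trans (neg-cong num≈)
        (≡⇒≈ (trans (ℤP.neg-distribˡ-* z (↧ x)) (cong ((- z) *_) (sym (ℚP.↧-neg x)))))))

  ↦-- : ∀ {x y z w} → x ↦ z → y ↦ w → x ℚ.- y ↦ z - w
  ↦-- x↦z y↦w = ↦-+ x↦z (↦-neg y↦w)

  ↦-^ : ∀ {x z} n → x ↦ z → x ^ℚ n ↦ z ^ n
  ↦-^ zero    _   = ↦-1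
  ↦-^ (suc n) x↦z = ↦-* x↦z (↦-^ n x↦z)

  ↦-sum : ∀ n {f g} → (∀ k → f k ↦ g k) → sumTo n f ↦ sumℤ n g
  ↦-sum zero    f↦g = f↦g 0
  ↦-sum (suc n) f↦g = ↦-+ (↦-sum n f↦g) (f↦g (suc n))

  ≡ℚ⇒≈ : ∀ {x y z w} → x ↦ z → y ↦ w → x ≡ℚ y [modℚ p ] → z ≈ w
  ≡ℚ⇒≈ {x} {y} {z} {w} x↦z y↦w p∣num =
    [ difference≈0⇒≈ , (λ den≈0 → ⊥-elim (den-unit x-y↦ (ℤ∣.∣⇒∣ᵤ (≈0⇒∣ den≈0)))) ]′
    (*≈0⇒ (z - w) (↧ (x ℚ.- y)) (≈-trans (≈-sym (num≈ x-y↦)) (∣⇒≈0 (ℤ∣.∣ᵤ⇒∣ p∣num))))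
    where x-y↦ : x ℚ.- y ↦ z - w
          x-y↦ = ↦-- x↦z y↦w

  ≈⇒≡ℚ : ∀ {x y z w} → x ↦ z → y ↦ w → z ≈ w → x ≡ℚ y [modℚ p ]
  ≈⇒≡ℚ {x} {y} x↦z y↦w z≈w = ℤ∣.∣⇒∣ᵤ (≈0⇒∣ (≈-trans (num≈ (↦-- x↦z y↦w))
    (≈-trans (*-cong (difference≈0 z≈w) ≈-refl) (≡⇒≈ (ℤP.*-zeroˡ (↧ (x ℚ.- y)))))))

  square-transfer : ∀ {r u} → r ↦ u → IsSquare u → ∃ λ x → r ≡ℚ ℤtoℚ x ℚ.* ℤtoℚ x [modℚ p ]
  square-transfer r↦u (x , u≈xx) = x , ≈⇒≡ℚ r↦u (↦-* (↦-ℤ x) (↦-ℤ x)) u≈xx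

  square-reflect : ∀ {r u} → r ↦ u → (∃ λ x → r ≡ℚ ℤtoℚ x ℚ.* ℤtoℚ x [modℚ p ]) → IsSquare u
  square-reflect r↦u (x , r≡xx) = x , ≡ℚ⇒≈ r↦u (↦-* (↦-ℤ x) (↦-ℤ x)) r≡xx

module OddPrime (h : ℕ) (p-prime : Prime (suc (h ℕ.+ h))) where

  p : ℕ
  p = suc (h ℕ.+ h)

  open ModPrime p p-prime public
  open ≈-Reasoning

  h-positive : ∃ λ h′ → h ≡ suc h′
  h-positive = split h refl
    where
    split : ∀ m → h ≡ m → ∃ λ h′ → h ≡ suc h′
    split zero    h≡0 = ⊥-elim (ℕP.<-irrefl refl (subst (λ m → 1 ℕ.< suc (m ℕ.+ m)) h≡0 1<p))
    split (suc m) h≡m = m , h≡m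

  p∣C : ∀ k → suc k ℕ.≤ h ℕ.+ h → + (p C suc k) ≈ + 0
  p∣C k k<2h = *-cancelˡ (pos≉0 (s≤s z≤n) (s≤s k<2h)) (begin
    + suc k * + (p C suc k)      ≡⟨ ℤP.pos-* (suc k) _ ⟨
    + (suc k ℕ.* (p C suc k))    ≡⟨ cong +_ (C-absorb (h ℕ.+ h) k) ⟩
    + (p ℕ.* ((h ℕ.+ h) C k))    ≡⟨ trans (ℤP.pos-* p _) (ℤP.*-comm (+ p) _) ⟩
    + ((h ℕ.+ h) C k) * + p      ≈⟨ multiple≈0 (+ ((h ℕ.+ h) C k)) ⟩
    + 0                          ≡⟨ ℤP.*-zeroʳ (+ suc k) ⟨
    + suc k * + 0                ∎)

  frobenius : ∀ y → (+ 1 + y) ^ p ≈ + 1 + y ^ p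
  frobenius y = begin
    (+ 1 + y) ^ p                                       ≡⟨ binomial-theorem p y ⟩
    sumℤ (h ℕ.+ h) term + term p                        ≈⟨ +-cong (sumℤ-≈-first (h ℕ.+ h) term inner≈0) ≈-refl ⟩
    + 1 + + (p C p) * y ^ p                             ≡⟨ cong (λ c → + 1 + + c * y ^ p) (nCn≡1 p) ⟩
    + 1 + + 1 * y ^ p                                   ≡⟨ cong (λ t → + 1 + t) (ℤP.*-identityˡ (y ^ p)) ⟩
    + 1 + y ^ p                                         ∎
    where
    term : ℕ → ℤ
    term j = + (p C j) * y ^ j
    inner≈0 : ∀ j → 1 ℕ.≤ j → j ℕ.≤ h ℕ.+ h → term j ≈ + 0
    inner≈0 (suc k) _ k<2h = ≈-trans (*-cong (p∣C k k<2h) ≈-refl) (≡⇒≈ (ℤP.*-zeroˡ (y ^ suc k)))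

  -- Fermat's little theorem x^p ≡ x: for naturals by induction using Frobenius,
  -- for negative integers because p is odd.
  fermat-ℕ : ∀ n → (+ n) ^ p ≈ + n
  fermat-ℕ zero    = ≡⇒≈ (ℤP.*-zeroˡ ((+ 0) ^ (h ℕ.+ h)))
  fermat-ℕ (suc n) = ≈-trans (frobenius (+ n)) (+-cong (≈-refl {+ 1}) (fermat-ℕ n))

  fermat : ∀ x → x ^ p ≈ x
  fermat (+ n)    = fermat-ℕ n
  fermat -[1+ n ] = ≈-trans (≡⇒≈ (neg-^-odd (+ suc n) h)) (neg-cong (fermat-ℕ (suc n)))

  fermat-unit : ∀ {x} → ¬ x ≈ + 0 → x ^ (h ℕ.+ h) ≈ + 1
  fermat-unit {x} x≉0 = *-cancelˡ x≉0 (≈-trans (fermat x) (≡⇒≈ (sym (ℤP.*-identityʳ x))))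

  half-power-squared : ∀ {u} → ¬ u ≈ + 0 → u ^ h * u ^ h ≈ + 1
  half-power-squared {u} u≉0 = ≈-trans (≡⇒≈ (sym (ℤP.^-distribˡ-+-* u h h))) (fermat-unit u≉0)

  euler-square : ∀ {u} → ¬ u ≈ + 0 → IsSquare u → u ^ h ≈ + 1
  euler-square {u} u≉0 (x , u≈xx) = begin
    u ^ h          ≈⟨ ^-cong h u≈xx ⟩
    (x * x) ^ h    ≡⟨ ^-double x h ⟨
    x ^ (h ℕ.+ h)  ≈⟨ fermat-unit x≉0 ⟩
    + 1            ∎
    where x≉0 : ¬ x ≈ + 0
          x≉0 x≈0 = u≉0 (≈-trans u≈xx (*-cong x≈0 x≈0))

  -- The squares 1², …, h² are pairwise incongruent: their differences factor as (j-i)(i+j+2).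
  square : ℕ → ℤ
  square i = + suc i * + suc i

  distinct-squares : ∀ {i j} → i ℕ.< j → j ℕ.< h → ¬ square i ≈ square j
  distinct-squares {i} {j} i<j j<h si≈sj = [ difference≉0 , sum≉0 ]′
    (*≈0⇒ (+ suc j - + suc i) (+ suc j + + suc i)
          (≈-trans (≡⇒≈ (factor (+ suc j) (+ suc i))) (difference≈0 (≈-sym si≈sj))))
    where
    factor : ∀ a b → (a - b) * (a + b) ≡ a * a - b * b
    factor = solve-∀
    difference≡ : + suc j - + suc i ≡ + (j ℕ.∸ i)
    difference≡ = trans (ℤP.[+m]-[+n]≡m⊖n (suc j) (suc i)) (ℤP.⊖-≥ (s≤s (ℕP.<⇒≤ i<j)))
    difference≉0 : ¬ + suc j - + suc i ≈ + 0
    difference≉0 = subst (λ d → ¬ d ≈ + 0) (sym difference≡)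
      (pos≉0 (ℕP.m<n⇒0<n∸m i<j) (s≤s (ℕP.≤-trans (ℕP.m∸n≤m j i) (ℕP.≤-trans (ℕP.<⇒≤ j<h) (ℕP.m≤m+n h h)))))
    sum≉0 : ¬ + suc j + + suc i ≈ + 0
    sum≉0 = pos≉0 (s≤s z≤n) (s≤s (ℕP.+-mono-≤ j<h (ℕP.<-trans i<j j<h)))

  -- A nonsquare u cannot satisfy u^h ≡ 1: otherwise u, 1², …, h² would be h + 1
  -- distinct roots of x^h - 1.
  nonsquare-not-root : ∀ {u} → ¬ IsSquare u → ¬ u ^ h ≈ + 1
  nonsquare-not-root {u} u-nonsquare u^h≈1 =
    ℕP.<-irrefl refl (subst (λ m → suc m ℕ.≤ suc h′) h≡1+h′ too-many)
    where
    h′ : ℕ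
    h′ = proj₁ h-positive
    h≡1+h′ : h ≡ suc h′
    h≡1+h′ = proj₂ h-positive
    roots : List ℤ
    roots = u ∷ applyUpTo square h
    distinct : Distinct roots
    distinct = AllProperties.applyUpTo⁺₁ square h (λ {i} _ u≈si → u-nonsquare (+ suc i , u≈si))
             ∷ AllPairs.applyUpTo⁺₁ square h distinct-squares
    are-roots : All (λ r → r ^ suc h′ ≈ + 1) roots
    are-roots = subst (λ m → All (λ r → r ^ m ≈ + 1) roots) h≡1+h′
      (u^h≈1 ∷ AllProperties.applyUpTo⁺₁ square h (λ {i} i<h →
         ≈-trans (≡⇒≈ (sym (^-double (+ suc i) h)))
                 (fermat-unit (pos≉0 (s≤s z≤n) (s≤s (ℕP.≤-trans i<h (ℕP.m≤m+n h h)))))))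
    too-many : suc h ℕ.≤ suc h′
    too-many = subst (ℕ._≤ suc h′) (cong suc (length-applyUpTo square h))
                     (unity-root-bound h′ roots distinct are-roots)

  -- Euler's criterion, hard half: a nonzero nonsquare u satisfies u^h ≡ -1, as u^h is
  -- a square root of 1 other than 1.
  euler-nonsquare : ∀ {u} → ¬ u ≈ + 0 → ¬ IsSquare u → u ^ h ≈ - + 1
  euler-nonsquare u≉0 u-nonsquare =
    [ ⊥-elim ∘ nonsquare-not-root u-nonsquare , (λ u^h≈-1 → u^h≈-1) ]′ (square≈1 (half-power-squared u≉0))

  -- C(2j,j) ≡ (-4)^j C(h,j) for j ≤ h: both sides obey the same recurrence, because
  -- 2(2i+1) ≡ -4(h-i) modulo p = 2h+1.
  central-≈ : ∀ j → j ℕ.≤ h → + ((j ℕ.+ j) C j) ≈ (- + 4) ^ j * + (h C j)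
  central-≈ zero    _     = ≈-refl
  central-≈ (suc i) 1+i≤h = *-cancelˡ {+ suc i} {+ ((suc i ℕ.+ suc i) C suc i)} {d (suc i)} 1+i≉0 (begin
    + suc i * + ((suc i ℕ.+ suc i) C suc i)          ≡⟨ central-recℤ i ⟩
    + 2 * ((+ 1 + (+ i + + i)) * + ((i ℕ.+ i) C i))  ≈⟨ *-congˡ (+ 2) (*-congˡ (+ 1 + (+ i + + i)) IH) ⟩
    + 2 * ((+ 1 + (+ i + + i)) * d i)                ≡⟨ modulus-multiple (+ h) (+ i) (d i) ⟩
    e + + 2 * d i * + p                              ≈⟨ +-congˡ e (multiple≈0 (+ 2 * d i)) ⟩
    e + + 0                                          ≡⟨ trans (ℤP.+-identityʳ e) (sym (d-rec i)) ⟩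
    + suc i * d (suc i)                              ∎)
    where
    1+i≉0 : ¬ + suc i ≈ + 0
    1+i≉0 = pos≉0 (s≤s z≤n) (s≤s (ℕP.≤-trans 1+i≤h (ℕP.m≤m+n h h)))
    d : ℕ → ℤ
    d j = (- + 4) ^ j * + (h C j)
    IH : + ((i ℕ.+ i) C i) ≈ d i
    IH = central-≈ i (ℕP.<⇒≤ 1+i≤h)
    d-rec : ∀ i → + suc i * d (suc i) ≡ (- + 4) * (+ h - + i) * d i
    d-rec i = trans (regroup (+ suc i) ((- + 4) ^ i) (+ (h C suc i)))
                    (trans (cong (λ t → (- + 4) * (- + 4) ^ i * t) (C-absorbℤ h i))
                           (regroup′ ((- + 4) ^ i) (+ h - + i) (+ (h C i))))
      where
      regroup : ∀ a q b → a * ((- + 4) * q * b) ≡ (- + 4) * q * (a * b)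
      regroup = solve-∀
      regroup′ : ∀ q m b → (- + 4) * q * (m * b) ≡ (- + 4) * m * (q * b)
      regroup′ = solve-∀
    e : ℤ
    e = (- + 4) * (+ h - + i) * d i
    modulus-multiple : ∀ H I D → + 2 * ((+ 1 + (I + I)) * D)
                                   ≡ (- + 4) * (H - I) * D + + 2 * D * (+ 1 + (H + H))
    modulus-multiple = solve-∀

  central-sum : ∀ x → sumℤ h (λ j → + ((j ℕ.+ j) C j) * x ^ j) ≈ (+ 1 - + 4 * x) ^ h
  central-sum x = begin
    sumℤ h (λ j → + ((j ℕ.+ j) C j) * x ^ j)          ≈⟨ sumℤ-≈ h (λ j j≤h → *-cong (central-≈ j j≤h) ≈-refl) ⟩
    sumℤ h (λ j → (- + 4) ^ j * + (h C j) * x ^ j)    ≡⟨ sumℤ-cong h regroup ⟩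
    sumℤ h (λ j → + (h C j) * ((- + 4) * x) ^ j)      ≡⟨ binomial-theorem h ((- + 4) * x) ⟨
    (+ 1 + (- + 4) * x) ^ h                           ≡⟨ cong (_^ h) (minus x) ⟩
    (+ 1 - + 4 * x) ^ h                               ∎
    where
    regroup : ∀ j → (- + 4) ^ j * + (h C j) * x ^ j ≡ + (h C j) * ((- + 4) * x) ^ j
    regroup j = trans (commute ((- + 4) ^ j) (+ (h C j)) (x ^ j))
                      (cong (+ (h C j) *_) (sym (^-distrib-* (- + 4) x j)))
      where commute : ∀ a b c → a * b * c ≡ b * (a * c)
            commute = solve-∀
    minus : ∀ x → + 1 + (- + 4) * x ≡ + 1 - + 4 * x
    minus = solve-∀

  quarter : ∀ t → (h ≡ t ℕ.+ t ⊎ h ≡ suc (t ℕ.+ t)) → p ℕ./ 4 ≡ t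
  quarter t (inj₁ h≡2t)   = trans (cong (λ m → suc (m ℕ.+ m) ℕ./ 4) h≡2t)
                                  (trans (cong (ℕ._/ 4) (as-4t+1 t)) (div-4 1 t (s≤s (s≤s z≤n))))
    where as-4t+1 : ∀ t → suc ((t ℕ.+ t) ℕ.+ (t ℕ.+ t)) ≡ 1 ℕ.+ t ℕ.* 4
          as-4t+1 = ℕRing.solve-∀
  quarter t (inj₂ h≡2t+1) = trans (cong (λ m → suc (m ℕ.+ m) ℕ./ 4) h≡2t+1)
                                  (trans (cong (ℕ._/ 4) (as-4t+3 t)) (div-4 3 t (s≤s (s≤s (s≤s (s≤s z≤n))))))
    where as-4t+3 : ∀ t → suc (suc (t ℕ.+ t) ℕ.+ suc (t ℕ.+ t)) ≡ 3 ℕ.+ t ℕ.* 4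
          as-4t+3 = ℕRing.solve-∀

  ^h-≈0 : ∀ {z} → z ≈ + 0 → z ^ h ≈ + 0
  ^h-≈0 {z} z≈0 with h-positive
  ... | h′ , h≡1+h′ = subst (λ m → z ^ m ≈ + 0) (sym h≡1+h′)
                            (≈-trans (*-cong z≈0 (≈-refl {z ^ h′})) (≡⇒≈ (ℤP.*-zeroˡ (z ^ h′))))

  ^h-unit⇒≉0 : ∀ {z s} → z ^ h ≈ s → s * s ≡ + 1 → ¬ z ≈ + 0
  ^h-unit⇒≉0 {z} {s} z^h≈s ss≡1 z≈0 = 1≉0 (begin
    + 1    ≡⟨ ss≡1 ⟨
    s * s  ≈⟨ *-cong s≈0 s≈0 ⟩
    + 0    ∎)
    where s≈0 : s ≈ + 0
          s≈0 = ≈-trans (≈-sym z^h≈s) (^h-≈0 z≈0)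

  -- Every p-integral rational reduces to an integer: multiply the numerator by the
  -- inverse d^{p-2} of the denominator d.
  reduction : ∀ a → pIntegral p a → ∃ λ z → a ↦ z
  reduction a p∤d with h-positive
  ... | h′ , h≡1+h′ = ↥ a * d ^ (h′ ℕ.+ h) , mk↦ p∤d (begin
    ↥ a                        ≡⟨ ℤP.*-identityʳ (↥ a) ⟨
    ↥ a * + 1                  ≈⟨ *-congˡ (↥ a) (≈-sym inverse) ⟩
    ↥ a * (d ^ (h′ ℕ.+ h) * d)  ≡⟨ ℤP.*-assoc (↥ a) _ d ⟨
    ↥ a * d ^ (h′ ℕ.+ h) * d    ∎)
    where
    d : ℤ
    d = ↧ a
    inverse : d ^ (h′ ℕ.+ h) * d ≈ + 1
    inverse = ≈-trans (≡⇒≈ (trans (ℤP.*-comm _ d) (cong (λ m → d ^ (m ℕ.+ h)) (sym h≡1+h′))))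
                      (fermat-unit (¬p∣⇒≉0 p∤d))

  reduction≉0 : ∀ {r z} → r ↦ z → ¬ r ≡ℚ 0ℚ [modℚ p ] → ¬ z ≈ + 0
  reduction≉0 {r} {z} r↦z r≢0 z≈0 = r≢0 (≈⇒≡ℚ {r} {0ℚ} {z} {+ 0} r↦z ↦-0 z≈0)

  legendre-euler : ∀ {r z ε} → r ↦ z → Legendre p r ε → z ^ h ≈ ε
  legendre-euler {r} {z} r↦z (leg0 r≡0) =
    ^h-≈0 (≡ℚ⇒≈ {r} {0ℚ} {z} {+ 0} r↦z ↦-0 r≡0)
  legendre-euler r↦z (leg1 r≢0 square) =
    euler-square (reduction≉0 r↦z r≢0) (square-reflect r↦z square)
  legendre-euler r↦z (leg-1 r≢0 nonsquare) =
    euler-nonsquare (reduction≉0 r↦z r≢0) (nonsquare ∘ square-transfer r↦z)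

  two≉0 : ¬ + 2 ≈ + 0
  two≉0 = pos≉0 (s≤s z≤n) (s≤s (ℕP.+-mono-≤ 1≤h 1≤h))
    where 1≤h : 1 ℕ.≤ h
          1≤h = subst (1 ℕ.≤_) (sym (proj₂ h-positive)) (s≤s z≤n)

  module SumAt (a : ℚ) (a-integral : pIntegral p a) where

    z : ℤ
    z = proj₁ (reduction a a-integral)

    a↦z : a ↦ z
    a↦z = proj₂ (reduction a a-integral)

    u v w : ℤ
    u = + 1 - + 4 * z
    v = + 1 + + 4 * z
    w = + 1 - + 16 * z * z

    w≡uv : w ≡ u * v
    w≡uv = factor z
      where factor : ∀ z → + 1 - + 16 * z * z ≡ (+ 1 - + 4 * z) * (+ 1 + + 4 * z)
            factor = solve-∀

    U↦u : 1ℚ ℚ.- ℤtoℚ (+ 4) ℚ.* a ↦ u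
    U↦u = ↦-- ↦-1 (↦-* (↦-ℤ (+ 4)) a↦z)

    W↦w : 1ℚ ℚ.- ℤtoℚ (+ 16) ℚ.* a ℚ.* a ↦ w
    W↦w = ↦-- ↦-1 (↦-* (↦-* (↦-ℤ (+ 16)) a↦z) a↦z)

    S : ℚ
    S = sumTo (p ℕ./ 4) (λ k → ℕtoℚ ((4 ℕ.* k) C (2 ℕ.* k)) ℚ.* (a ^ℚ (2 ℕ.* k)))

    σ : ℤ
    σ = sumℤ (p ℕ./ 4) (λ k → + ((4 ℕ.* k) C (2 ℕ.* k)) * z ^ (2 ℕ.* k))

    S↦σ : S ↦ σ
    S↦σ = ↦-sum (p ℕ./ 4) (λ k → ↦-* (↦-ℤ (+ ((4 ℕ.* k) C (2 ℕ.* k)))) (↦-^ (2 ℕ.* k) a↦z))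

    twice-σ : + 2 * σ ≈ u ^ h + v ^ h
    twice-σ with parity h
    ... | t , h-parity = begin
      + 2 * σ                                        ≡⟨ cong (λ n → + 2 * sumℤ n _) (quarter t h-parity) ⟩
      + 2 * sumℤ t (λ k → + ((4 ℕ.* k) C (2 ℕ.* k)) * z ^ (2 ℕ.* k))
                                                     ≡⟨ cong (+ 2 *_) (sumℤ-cong t doubled-index) ⟩
      + 2 * sumℤ t (λ k → c (k ℕ.+ k) * z ^ (k ℕ.+ k)) ≡⟨ even-terms c z t h h-parity ⟨
      sumℤ h (λ j → c j * z ^ j) + sumℤ h (λ j → c j * (- z) ^ j)
                                                     ≈⟨ +-cong (central-sum z) (central-sum (- z)) ⟩
      u ^ h + (+ 1 - + 4 * - z) ^ h                  ≡⟨ cong (λ y → u ^ h + y ^ h) (minus-minus z) ⟩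
      u ^ h + v ^ h                                  ∎
      where
      c : ℕ → ℤ
      c j = + ((j ℕ.+ j) C j)
      doubled-index : ∀ k → + ((4 ℕ.* k) C (2 ℕ.* k)) * z ^ (2 ℕ.* k) ≡ c (k ℕ.+ k) * z ^ (k ℕ.+ k)
      doubled-index k = cong₂ (λ m n → + (m C n) * z ^ n) (four k) (two k)
        where four : ∀ k → 4 ℕ.* k ≡ (k ℕ.+ k) ℕ.+ (k ℕ.+ k)
              four = ℕRing.solve-∀
              two : ∀ k → 2 ℕ.* k ≡ k ℕ.+ k
              two = ℕRing.solve-∀
      minus-minus : ∀ z → + 1 - + 4 * - z ≡ + 1 + + 4 * z
      minus-minus = solve-∀

    -- Since u^h u^h ≡ 1: v^h ≡ u^h (u^h v^h) = u^h w^h, hence 2σ ≡ u^h (1 + w^h).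
    twice-σ-factored : ¬ u ≈ + 0 → + 2 * σ ≈ u ^ h * (+ 1 + w ^ h)
    twice-σ-factored u≉0 = begin
      + 2 * σ                            ≈⟨ twice-σ ⟩
      u ^ h + v ^ h                      ≈⟨ +-congˡ (u ^ h) v^h≈ ⟩
      u ^ h + (u ^ h * u ^ h) * v ^ h    ≡⟨ regroup (u ^ h) (v ^ h) ⟩
      u ^ h * (+ 1 + u ^ h * v ^ h)      ≡⟨ cong (λ y → u ^ h * (+ 1 + y)) (sym (^-distrib-* u v h)) ⟩
      u ^ h * (+ 1 + (u * v) ^ h)        ≡⟨ cong (λ y → u ^ h * (+ 1 + y ^ h)) (sym w≡uv) ⟩
      u ^ h * (+ 1 + w ^ h)              ∎
      where
      v^h≈ : v ^ h ≈ (u ^ h * u ^ h) * v ^ h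
      v^h≈ = ≈-trans (≡⇒≈ (sym (ℤP.*-identityˡ (v ^ h))))
                     (*-cong (≈-sym (half-power-squared u≉0)) (≈-refl {v ^ h}))
      regroup : ∀ x y → x + (x * x) * y ≡ x * (+ 1 + x * y)
      regroup = solve-∀

    -- w ≢ 0 whenever w^h ≡ ±1, hence also its factor u ≢ 0.
    u≉0 : ∀ {s} → w ^ h ≈ s → s * s ≡ + 1 → ¬ u ≈ + 0
    u≉0 w^h≈s ss≡1 = proj₁ (*≉0⇒ u v (subst (λ y → ¬ y ≈ + 0) w≡uv (^h-unit⇒≉0 w^h≈s ss≡1)))

    nonresidue-case : Legendre p (1ℚ ℚ.- ℤtoℚ (+ 16) ℚ.* a ℚ.* a) (- + 1) → S ≡ℚ 0ℚ [modℚ p ]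
    nonresidue-case W-nonres = ≈⇒≡ℚ S↦σ ↦-0 (*-cancelˡ {+ 2} {σ} {+ 0} two≉0 (begin
      + 2 * σ                   ≈⟨ twice-σ-factored (u≉0 w^h≈-1 refl) ⟩
      u ^ h * (+ 1 + w ^ h)     ≈⟨ *-congˡ (u ^ h) (+-congˡ (+ 1) w^h≈-1) ⟩
      u ^ h * (+ 1 + - + 1)     ≡⟨ ℤP.*-zeroʳ (u ^ h) ⟩
      + 0                       ≡⟨ ℤP.*-zeroʳ (+ 2) ⟨
      + 2 * + 0                 ∎))
      where w^h≈-1 : w ^ h ≈ - + 1
            w^h≈-1 = legendre-euler W↦w W-nonres

    residue-case : Legendre p (1ℚ ℚ.- ℤtoℚ (+ 16) ℚ.* a ℚ.* a) (+ 1) →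
                   ∀ ε → Legendre p (1ℚ ℚ.- ℤtoℚ (+ 4) ℚ.* a) ε → S ≡ℚ ℤtoℚ ε [modℚ p ]
    residue-case W-res ε U-leg = ≈⇒≡ℚ S↦σ (↦-ℤ ε) (*-cancelˡ {+ 2} {σ} {ε} two≉0 (begin
      + 2 * σ                   ≈⟨ twice-σ-factored (u≉0 w^h≈1 refl) ⟩
      u ^ h * (+ 1 + w ^ h)     ≈⟨ *-cong (legendre-euler U↦u U-leg) (+-congˡ (+ 1) w^h≈1) ⟩
      ε * + 2                   ≡⟨ ℤP.*-comm ε (+ 2) ⟩
      + 2 * ε                   ∎))
      where w^h≈1 : w ^ h ≈ + 1
            w^h≈1 = legendre-euler W↦w W-res

odd-form : ∀ n → ¬ 2 ℕ∣.∣ n → ∃ λ h → n ≡ suc (h ℕ.+ h)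
odd-form n 2∤n with parity n
... | t , inj₁ n≡2t   = ⊥-elim (2∤n (ℕ∣.divides t (trans n≡2t (twice t))))
  where twice : ∀ t → t ℕ.+ t ≡ t ℕ.* 2
        twice = ℕRing.solve-∀
... | t , inj₂ n≡2t+1 = t , n≡2t+1

-- The theorem.
theorem2p9 : (p : ℕ) → Prime p → ¬ (2 ℕ∣.∣ p) → (a : ℚ) → pIntegral p a →
    ¬ (ℤtoℚ (+ 16) ℚ.* a ℚ.* a ℚ.- 1ℚ  ≡ℚ 0ℚ [modℚ p ]) →
    let S = sumTo (p ℕ./ 4) (λ k → ℕtoℚ ((4 ℕ.* k) C (2 ℕ.* k)) ℚ.* (a ^ℚ (2 ℕ.* k)))
    in (Legendre p (1ℚ ℚ.- ℤtoℚ (+ 16) ℚ.* a ℚ.* a) (ℤ.- (+ 1)) → S  ≡ℚ 0ℚ [modℚ p ])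
       × (Legendre p (1ℚ ℚ.- ℤtoℚ (+ 16) ℚ.* a ℚ.* a) (+ 1) →
          (ε : ℤ) → Legendre p (1ℚ ℚ.- ℤtoℚ (+ 4) ℚ.* a) ε → S  ≡ℚ ℤtoℚ ε [modℚ p ])
theorem2p9 p p-prime 2∤p a a-integral _ with odd-form p 2∤p
... | h , refl = nonresidue-case , residue-case
  where open OddPrime.SumAt h p-prime a a-integral
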